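{- Let $k$ be a positive integer and $n$ a nonnegative integer, and let $(a_j)_{j\ge1}$ be the $[k]$-LID sequence, with the convention $a_j=0$ for $j\le 0$. Then the largest integer $m$ of the form $m=\sum_{\ell\in L}a_\ell$ with $L\subseteq\{1,\dots,n\}$ and $|i-j|\notin[k]$ for all $i,j\in L$ is \[ \sum_{i=0}^{\lfloor (n+1)/(k+1)\rfloor} a_{n-i(k+1)}. \] Moreover, \[ a_{n+1} \le 1+\sum_{i=0}^{\lfloor (n+1)/(k+1)\rfloor} a_{n-i(k+1)}. \]
   Context: $[k]=\{1,\dots,k\}$. For a set $S$ of positive integers, the $S$-legal index difference ($S$-LID) sequence $(a_n)_{n\ge 1}$ is defined recursively: for each positive integer $n$, $a_n$ is the smallest positive integer that cannot be written as $\sum_{\ell\in L} a_\ell$ for some set $L \subseteq \{1,\dots,n-1\}$ such that $|i-j|\notin S$ for all $i,j\in L$ (the empty sum is $0$). -}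

module Defs where

open import Data.Nat using (ℕ; zero; suc; _+_; _*_; _∸_; _≤_; _<_; ∣_-_∣; _/_)
open import Data.Integer as ℤ using (ℤ; +_; -[1+_])
open import Data.List using (List; map; upTo)
open import Data.Nat.ListAction using (sum)
open import Data.List.Membership.Propositional using (_∈_)
open import Data.List.Relation.Unary.All using (All)
open import Data.List.Relation.Unary.Unique.Propositional using (Unique)
open import Data.Product using (_×_; ∃)
open import Relation.Nullary using (¬_)
open import Relation.Binary.PropositionalEquality using (_≡_)

-- A finite set L ⊆ {1,…,n} of indices, represented as a duplicate-free list,
-- such that |i - j| ∉ [k] = {1,…,k} for all i, j ∈ L.
Legal : (k n : ℕ) → List ℕ → Set
Legal k n L =
  Unique L
  × All (λ x → 1 ≤ x × x ≤ n) L
  × (∀ {i j} → i ∈ L → j ∈ L → ¬ (1 ≤ ∣ i - j ∣ × ∣ i - j ∣ ≤ k))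

Representable : (k : ℕ) (a : ℕ → ℕ) (n m : ℕ) → Set
Representable k a n m = ∃ λ L → Legal k n L × sum (map a L) ≡ m

-- a is the [k]-LID sequence: for every n ≥ 1 (written suc n), a_n is the
-- smallest positive integer not representable using indices in {1,…,n-1}.
-- (The value a 0 is irrelevant and unconstrained.)
IsLID : (k : ℕ) (a : ℕ → ℕ) → Set
IsLID k a = ∀ n →
  1 ≤ a (suc n)
  × ¬ Representable k a n (a (suc n))
  × (∀ m → 1 ≤ m → m < a (suc n) → Representable k a n m)

ext : (ℕ → ℕ) → ℤ → ℕ
ext a (+ zero)   = 0
ext a (+ suc j)  = a (suc j)
ext a -[1+ j ]   = 0

bound : (k : ℕ) (a : ℕ → ℕ) (n : ℕ) → ℕ
bound k a n =
  sum (map (λ i → ext a (+ n ℤ.- + (i * suc k))) (upTo (suc ((suc n) / (suc k)))))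

{-# OPTIONS --safe #-}
module Submission where

-- Write B n for the claimed maximum. Unfolding the sum gives B 0 = 0 and
-- B n = a_n + B (n - k - 1), i.e. B n is the value of the greedy set
-- {n, n - (k+1), n - 2(k+1), …}, which is legal. Conversely, by strong induction
-- on n, a legal L ⊆ [1, n] either avoids n, and then Σ L ≤ B (n - 1) ≤ B n, or
-- contains n, and then L ∖ {n} is a legal subset of [1, n - k - 1]. The step
-- B (n - 1) ≤ B n holds because the LID sequence is nondecreasing: a smaller
-- a_{n+1} would already be representable with indices below n. Finally B n + 1
-- is not representable, so the least such number a_{n+1} is at most B n + 1.

open import Defs
open import Data.Nat using (ℕ; zero; suc; _+_; _*_; _∸_; _/_; _≤_; _<_; ∣_-_∣; z≤n; s≤s; s≤s⁻¹; z<s; _≤?_)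
open import Data.Nat.Properties
open import Data.Nat.DivMod using (m/n≡1+[m∸n]/n)
open import Data.Nat.Induction using (<-rec)
open import Data.Nat.ListAction.Properties using (sum-↭)
open import Data.Integer as ℤ using (+_)
import Data.Integer.Properties as ℤ
open import Data.List using (List; []; _∷_; map; applyUpTo)
open import Data.List.Properties using (map-upTo)
open import Data.Nat.ListAction using (sum)
open import Function using (_∘_)
open import Relation.Binary.PropositionalEquality.Properties using (setoid)
open import Data.Product using (_×_; _,_; ∃)
open import Data.List.Membership.Propositional using (_∈_; _∉_)
open import Data.List.Membership.Propositional.Properties using (∈-∃++)
open import Data.List.Membership.DecPropositional _≟_ using (_∈?_)
open import Data.List.Relation.Unary.Any using (here; there)
open import Data.List.Relation.Unary.All as All using (All; []; _∷_)
open import Data.List.Relation.Unary.AllPairs using ([]; _∷_)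
open import Data.List.Relation.Binary.Permutation.Propositional using (_↭_; ↭-sym; ↭⇒↭ₛ)
open import Data.List.Relation.Binary.Permutation.Propositional.Properties using (shift; ∈-resp-↭; All-resp-↭; map⁺)
open import Data.List.Relation.Binary.Permutation.Setoid.Properties (setoid ℕ) using (Unique-resp-↭)
open import Relation.Nullary using (¬_; yes; no; contradiction)
open import Relation.Binary.PropositionalEquality

-- a_n with the convention a_0 = 0; the value a 0 itself is unconstrained.
ext⁺ : (ℕ → ℕ) → ℕ → ℕ
ext⁺ a n = ext a (+ n)

ext-neg : ∀ a d → ext a (ℤ.- + d) ≡ 0
ext-neg a zero    = refl
ext-neg a (suc d) = refl

ext-∸ : ∀ a n m → ext a (+ n ℤ.- + m) ≡ ext⁺ a (n ∸ m)
ext-∸ a n m with m ≤? n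
... | yes m≤n = cong (ext a) (trans (ℤ.m-n≡m⊖n n m) (ℤ.⊖-≥ m≤n))
... | no m≰n = begin
  ext a (+ n ℤ.- + m)    ≡⟨ cong (ext a) (trans (ℤ.m-n≡m⊖n n m) (ℤ.⊖-≰ m≰n)) ⟩
  ext a (ℤ.- + (m ∸ n))  ≡⟨ ext-neg a (m ∸ n) ⟩
  0                      ≡⟨ cong (ext⁺ a) (m≤n⇒m∸n≡0 (<⇒≤ (≰⇒> m≰n))) ⟨
  ext⁺ a (n ∸ m)         ∎
  where open ≡-Reasoning

module _ (s : ℕ) (f : ℕ → ℕ) where

  strided : ℕ → ℕ → ℕ
  strided zero    n = 0
  strided (suc T) n = f n + strided T (n ∸ s)

  sum-applyUpTo≡strided : ∀ T n (g : ℕ → ℕ) → (∀ i → g i ≡ f (n ∸ i * s)) →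
                          sum (applyUpTo g T) ≡ strided T n
  sum-applyUpTo≡strided zero    n g g≗ = refl
  sum-applyUpTo≡strided (suc T) n g g≗ = cong₂ _+_ (g≗ 0)
    (sum-applyUpTo≡strided T (n ∸ s) (g ∘ suc)
      (λ i → trans (g≗ (suc i)) (cong f (sym (∸-+-assoc n s (i * s))))))

  strided-zero : f 0 ≡ 0 → ∀ T → strided T 0 ≡ 0
  strided-zero f0≡0 zero    = refl
  strided-zero f0≡0 (suc T) = cong₂ _+_ f0≡0 (trans (cong (strided T) (0∸n≡0 s)) (strided-zero f0≡0 T))

module _ (k : ℕ) (a : ℕ → ℕ) where

  bound≡strided : ∀ n → bound k a n ≡ strided (suc k) (ext⁺ a) (suc (suc n / suc k)) n
  bound≡strided n = trans (cong sum (map-upTo term T))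
    (sum-applyUpTo≡strided (suc k) (ext⁺ a) T n term (λ i → ext-∸ a n (i * suc k)))
    where
      T : ℕ
      T = suc (suc n / suc k)
      term : ℕ → ℕ
      term = λ i → ext a (+ n ℤ.- + (i * suc k))

  bound-zero : bound k a 0 ≡ 0
  bound-zero = trans (bound≡strided 0) (strided-zero (suc k) (ext⁺ a) refl (suc (1 / suc k)))

  bound-step : ∀ n → bound k a n ≡ ext⁺ a n + bound k a (n ∸ suc k)
  bound-step n with suc k ≤? n
  ... | yes s≤n = trans (bound≡strided n) (cong (_+_ (ext⁺ a n)) (begin
    strided (suc k) (ext⁺ a) (suc n / suc k) (n ∸ suc k)
      ≡⟨ cong (λ T → strided (suc k) (ext⁺ a) T (n ∸ suc k)) quotient ⟩
    strided (suc k) (ext⁺ a) (suc (suc (n ∸ suc k) / suc k)) (n ∸ suc k)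
      ≡⟨ bound≡strided (n ∸ suc k) ⟨
    bound k a (n ∸ suc k) ∎))
    where
      open ≡-Reasoning
      quotient : suc n / suc k ≡ suc (suc (n ∸ suc k) / suc k)
      quotient = trans (m/n≡1+[m∸n]/n (m≤n⇒m≤1+n s≤n))
                       (cong (λ m → suc (m / suc k)) (+-∸-assoc 1 s≤n))
  ... | no s≰n = trans (bound≡strided n) (cong (_+_ (ext⁺ a n)) (begin
    strided (suc k) (ext⁺ a) (suc n / suc k) (n ∸ suc k) ≡⟨ cong (strided (suc k) (ext⁺ a) (suc n / suc k)) n∸s≡0 ⟩
    strided (suc k) (ext⁺ a) (suc n / suc k) 0           ≡⟨ strided-zero (suc k) (ext⁺ a) refl (suc n / suc k) ⟩
    0                                                   ≡⟨ bound-zero ⟨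
    bound k a 0                                         ≡⟨ cong (bound k a) n∸s≡0 ⟨
    bound k a (n ∸ suc k)                               ∎))
    where
      open ≡-Reasoning
      n∸s≡0 : n ∸ suc k ≡ 0
      n∸s≡0 = m≤n⇒m∸n≡0 (<⇒≤ (≰⇒> s≰n))

Apart : ℕ → ℕ → ℕ → Set
Apart k i j = ¬ (1 ≤ ∣ i - j ∣ × ∣ i - j ∣ ≤ k)

far⇒Apart : ∀ {k i j} → k < ∣ i - j ∣ → Apart k i j
far⇒Apart k<d (_ , d≤k) = <⇒≱ k<d d≤k

Apart⇒far : ∀ {k i j} → i ≢ j → Apart k i j → k < ∣ i - j ∣
Apart⇒far i≢j apart =
  ≰⇒> (λ d≤k → apart (n≢0⇒n>0 (i≢j ∘ ∣m-n∣≡0⇒m≡n) , d≤k))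

≤∸⇒far-from-suc : ∀ {k p j} → 1 ≤ j → j ≤ p ∸ k → k < ∣ suc p - j ∣
≤∸⇒far-from-suc {k} {p} {j} 1≤j j≤p∸k =
  subst (k <_) (sym (m≤n⇒∣n-m∣≡n∸m (m≤n⇒m≤1+n j≤p)))
        (m+n≤o⇒m≤o∸n (suc k) (s≤s (subst (_≤ p) (+-comm j k) j+k≤p)))
  where
    k≤p : k ≤ p
    k≤p = <⇒≤ (m∸n≢0⇒n<m (n>0⇒n≢0 (≤-trans 1≤j j≤p∸k)))
    j+k≤p : j + k ≤ p
    j+k≤p = m≤o∸n⇒m+n≤o j k≤p j≤p∸k
    j≤p : j ≤ p
    j≤p = ≤-trans (m≤m+n j k) j+k≤p

far-from-suc⇒≤∸ : ∀ {k p j} → j ≤ suc p → k < ∣ suc p - j ∣ → j ≤ p ∸ k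
far-from-suc⇒≤∸ {k} {p} {j} j≤1+p k<d = m+n≤o⇒m≤o∸n j (subst (_≤ p) (+-comm k j) (s≤s⁻¹ 1+k+j≤1+p))
  where
    1+k+j≤1+p : suc k + j ≤ suc p
    1+k+j≤1+p = m≤o∸n⇒m+n≤o (suc k) j≤1+p (subst (k <_) (m≤n⇒∣n-m∣≡n∸m j≤1+p) k<d)

∈⇒↭∷ : ∀ {ℓ} {A : Set ℓ} {x : A} {L : List A} → x ∈ L → ∃ λ L′ → L ↭ x ∷ L′
∈⇒↭∷ {x = x} x∈L with xs , ys , refl ← ∈-∃++ x∈L = _ , shift x xs ys

module _ {k : ℕ} where

  Apart-refl : ∀ i → Apart k i i
  Apart-refl i (1≤d , _) = n≮0 (subst (1 ≤_) (∣n-n∣≡0 i) 1≤d)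

  Legal-weaken : ∀ {n n′ L} → n ≤ n′ → Legal k n L → Legal k n′ L
  Legal-weaken n≤n′ (u , bs , apart) = u , All.map (λ (1≤x , x≤n) → 1≤x , ≤-trans x≤n n≤n′) bs , apart

  Legal-resp-↭ : ∀ {n L L′} → L ↭ L′ → Legal k n L → Legal k n L′
  Legal-resp-↭ σ (u , bs , apart) =
    Unique-resp-↭ (↭⇒↭ₛ σ) u , All-resp-↭ σ bs ,
    λ i∈ j∈ → apart (∈-resp-↭ (↭-sym σ) i∈) (∈-resp-↭ (↭-sym σ) j∈)

  Legal-zero : ∀ {L} → Legal k 0 L → L ≡ []
  Legal-zero {[]}    _                        = refl
  Legal-zero {x ∷ L} (_ , (1≤x , x≤0) ∷ _ , _) = contradiction (≤-trans 1≤x x≤0) λ ()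

  Legal-below-top : ∀ {p L} → suc p ∉ L → Legal k (suc p) L → Legal k p L
  Legal-below-top {p} {L} top∉L (u , bs , apart) = u , bs′ , apart
    where
      bs′ : All (λ x → 1 ≤ x × x ≤ p) L
      bs′ = All.tabulate λ x∈L → let (1≤x , x≤1+p) = All.lookup bs x∈L in
              1≤x , s≤s⁻¹ (≤∧≢⇒< x≤1+p λ { refl → top∉L x∈L })

  Legal-∷⁺ : ∀ {p L} → Legal k (p ∸ k) L → Legal k (suc p) (suc p ∷ L)
  Legal-∷⁺ {p} {L} (u , bs , apart) = (top∉L ∷ u) , (z<s , ≤-refl) ∷ All.map lift bs , apart′
    where
      lift : ∀ {x} → 1 ≤ x × x ≤ p ∸ k → 1 ≤ x × x ≤ suc p
      lift (1≤x , x≤) = 1≤x , ≤-trans x≤ (≤-trans (m∸n≤m p k) (n≤1+n p))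
      top∉L : All (suc p ≢_) L
      top∉L = All.map (λ (_ , x≤) → >⇒≢ (s≤s (≤-trans x≤ (m∸n≤m p k)))) bs
      far : ∀ {j} → j ∈ L → k < ∣ suc p - j ∣
      far j∈L = let (1≤j , j≤) = All.lookup bs j∈L in ≤∸⇒far-from-suc 1≤j j≤
      apart′ : ∀ {i j} → i ∈ suc p ∷ L → j ∈ suc p ∷ L → Apart k i j
      apart′ (here refl) (here refl) = Apart-refl (suc p)
      apart′ {j = j} (here refl) (there j∈) = far⇒Apart {i = suc p} {j} (far j∈)
      apart′ {i} (there i∈) (here refl) = far⇒Apart {i = i} {suc p} (subst (k <_) (∣-∣-comm (suc p) i) (far i∈))
      apart′ (there i∈) (there j∈) = apart i∈ j∈

  Legal-∷⁻ : ∀ {p L} → Legal k (suc p) (suc p ∷ L) → Legal k (p ∸ k) L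
  Legal-∷⁻ {p} {L} (top∉L ∷ u , _ ∷ bs , apart) = u , bs′ , λ i∈ j∈ → apart (there i∈) (there j∈)
    where
      bs′ : All (λ x → 1 ≤ x × x ≤ p ∸ k) L
      bs′ = All.tabulate λ {x} x∈L → let (1≤x , x≤1+p) = All.lookup bs x∈L in
        1≤x , far-from-suc⇒≤∸ x≤1+p (subst (k <_) (∣-∣-comm x (suc p))
                (Apart⇒far (λ x≡ → All.lookup top∉L x∈L (sym x≡)) (apart (there x∈L) (here refl))))

Representable-weaken : ∀ {k a n n′ m} → n ≤ n′ → Representable k a n m → Representable k a n′ m
Representable-weaken n≤n′ (L , legal , ΣL≡m) = L , Legal-weaken n≤n′ legal , ΣL≡m

bound-representable : ∀ k a n → Representable k a n (bound k a n)
bound-representable k a = <-rec _ go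
  where
    go : ∀ n → (∀ {m} → m < n → Representable k a m (bound k a m)) → Representable k a n (bound k a n)
    go zero    _  = [] , ([] , [] , λ ()) , sym (bound-zero k a)
    go (suc p) ih with L , legal , ΣL≡ ← ih {p ∸ k} (s≤s (m∸n≤m p k)) =
      suc p ∷ L , Legal-∷⁺ legal , trans (cong (_+_ (a (suc p))) ΣL≡) (sym (bound-step k a (suc p)))

module _ {k : ℕ} {a : ℕ → ℕ} (lid : IsLID k a) where

  LID-mono : ∀ n → ext⁺ a n ≤ ext⁺ a (suc n)
  LID-mono zero    = z≤n
  LID-mono (suc p) = ≮⇒≥ λ a₂<a₁ →
    let (1≤a₂ , a₂-unrepresentable , _) = lid (suc p)
        (_ , _ , below-a₁-representable) = lid p
    in a₂-unrepresentable (Representable-weaken (n≤1+n p) (below-a₁-representable _ 1≤a₂ a₂<a₁))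

  LID≤1+max : ∀ {n M} → (∀ m → Representable k a n m → m ≤ M) → a (suc n) ≤ suc M
  LID≤1+max {n} {M} ≤M = ≮⇒≥ λ 1+M<a →
    let (_ , _ , below-representable) = lid n
    in <-irrefl refl (≤M (suc M) (below-representable (suc M) z<s 1+M<a))

  bound-mono : ∀ n → bound k a n ≤ bound k a (suc n)
  bound-mono = <-rec _ go
    where
      go : ∀ n → (∀ {m} → m < n → bound k a m ≤ bound k a (suc m)) → bound k a n ≤ bound k a (suc n)
      go n ih = subst₂ _≤_ (sym (bound-step k a n)) (sym (bound-step k a (suc n)))
                  (+-mono-≤ (LID-mono n) tail-mono)
        where
          tail-mono : bound k a (n ∸ suc k) ≤ bound k a (suc n ∸ suc k)
          tail-mono with suc k ≤? n
          ... | yes s≤n = subst (bound k a (n ∸ suc k) ≤_) (cong (bound k a) (sym (+-∸-assoc 1 s≤n)))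
                            (ih (∸-monoʳ-< z<s s≤n))
          ... | no s≰n = subst (_≤ bound k a (suc n ∸ suc k))
                            (sym (trans (cong (bound k a) (m≤n⇒m∸n≡0 (<⇒≤ (≰⇒> s≰n)))) (bound-zero k a))) z≤n

  Legal⇒sum≤bound : ∀ n {L} → Legal k n L → sum (map a L) ≤ bound k a n
  Legal⇒sum≤bound = <-rec _ go
    where
      go : ∀ n → (∀ {m} → m < n → ∀ {L} → Legal k m L → sum (map a L) ≤ bound k a m) →
           ∀ {L} → Legal k n L → sum (map a L) ≤ bound k a n
      go zero    _  legal = ≤-trans (≤-reflexive (cong (sum ∘ map a) (Legal-zero legal))) z≤n
      go (suc p) ih {L} legal with suc p ∈? L
      ... | no top∉L = ≤-trans (ih ≤-refl (Legal-below-top top∉L legal)) (bound-mono p)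
      ... | yes top∈L with L′ , σ ← ∈⇒↭∷ top∈L = begin
        sum (map a L)                  ≡⟨ sum-↭ (map⁺ a σ) ⟩
        a (suc p) + sum (map a L′)     ≤⟨ +-monoʳ-≤ (a (suc p)) (ih (s≤s (m∸n≤m p k)) rest-legal) ⟩
        a (suc p) + bound k a (p ∸ k)  ≡⟨ bound-step k a (suc p) ⟨
        bound k a (suc p)              ∎
        where
          open ≤-Reasoning
          rest-legal : Legal k (p ∸ k) L′
          rest-legal = Legal-∷⁻ (Legal-resp-↭ σ legal)

  Representable⇒≤bound : ∀ n m → Representable k a n m → m ≤ bound k a n
  Representable⇒≤bound n m (L , legal , ΣL≡m) = subst (_≤ bound k a n) ΣL≡m (Legal⇒sum≤bound n legal)

lemma2p6 : (k : ℕ) → 0 < k → (a : ℕ → ℕ) → IsLID k a → (n : ℕ) →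
    (Representable k a n (bound k a n)
      × (∀ m → Representable k a n m → m ≤ bound k a n))
    × a (suc n) ≤ 1 + bound k a n
lemma2p6 k _ a lid n =
  (bound-representable k a n , Representable⇒≤bound lid n) , LID≤1+max lid (Representable⇒≤bound lid n)
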